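{- Let $n\ge8$. Then $F_{\{2,5\}}$ appears in the expansion of $\mathcal{S}_{(3,n-3)}$ in the basis of fundamental quasisymmetric functions with coefficient at least $2$.
   Context: For $S\subseteq[n-1]$, $F_S=\sum x_{i_1}\cdots x_{i_n}$ over $i_1\le\cdots\le i_n$ with $i_j<i_{j+1}$ whenever $j\in S$. The composition diagram of a composition $\alpha$ has $\alpha_i$ left-justified cells in row $i$ (top to bottom). Cover relation on compositions: $\beta\lessdot\gamma$ if $\gamma=(1)\cdot\beta$ (new top row of one cell, existing rows keeping their cells) or $\gamma$ is obtained from $\beta$ by adding $1$ to the leftmost part of $\beta$ equal to $k$, for some $k$ (cell added at the right end of that row). A standard composition tableau (SCT) of shape $\alpha\vDash n$ comes from a chain $\emptyset=\alpha^{n+1}\lessdot\cdots\lessdot\alpha^1=\alpha$ by putting $i$ in the cell added from $\alpha^{i+1}$ to $\alpha^i$. Its descent set $\mathrm{Des}(T)$ is the set of $i$ with $i+1$ in a column weakly right of the column of $i$. $\mathcal{S}_\alpha=\sum_T F_{\mathrm{Des}(T)}$ over SCT $T$ of shape $\alpha$. -}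

module Defs where

open import Data.Nat using (ℕ; zero; suc; _≤ᵇ_; _≡ᵇ_)
open import Data.Bool using (Bool; true; false; if_then_else_)
open import Data.List using (List; []; _∷_)
open import Data.Product using (Σ; _×_)
open import Relation.Binary.PropositionalEquality using (_≡_; _≢_)

-- Compositions are lists of (positive) parts, top row first.
Composition : Set
Composition = List ℕ

data Inc (k : ℕ) : Composition → Composition → Set where
  here  : ∀ {β} → Inc k (k ∷ β) (suc k ∷ β)
  there : ∀ {x β γ} → (x ≡ᵇ k) ≡ false → Inc k β γ → Inc k (x ∷ β) (x ∷ γ)

data Cover : Composition → Composition → Set where
  prepend : ∀ {β} → Cover β (1 ∷ β)
  incr    : ∀ {β γ} (k : ℕ) → Inc k β γ → Cover β γ

addedColumn : ∀ {β γ} → Cover β γ → ℕ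
addedColumn prepend    = 1
addedColumn (incr k _) = suc k

-- A standard composition tableau of shape α: a saturated chain
-- ∅ = α^{n+1} ⋖ ⋯ ⋖ α^1 = α.  The outermost 'step' is α^2 ⋖ α^1
-- (adding entry 1), the innermost is ∅ ⋖ α^n (adding entry n).
data SCT : Composition → Set where
  empty : SCT []
  step  : ∀ {β γ} → Cover β γ → SCT β → SCT γ

columns : ∀ {α} → SCT α → List ℕ
columns empty      = []
columns (step c T) = addedColumn c ∷ columns T

-- the chain of shapes α^1, α^2, …, α^{n+1} (determines the tableau)
shapes : ∀ {α} → SCT α → List Composition
shapes {α} empty      = α ∷ []
shapes {α} (step c T) = α ∷ shapes T

-- descents, listed increasingly: i is a descent iff col(i) ≤ col(i+1)
desFrom : ℕ → List ℕ → List ℕ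
desFrom i (a ∷ b ∷ rest) =
  if a ≤ᵇ b then i ∷ desFrom (suc i) (b ∷ rest) else desFrom (suc i) (b ∷ rest)
desFrom i _ = []

Des : ∀ {α} → SCT α → List ℕ
Des T = desFrom 1 (columns T)

{-# OPTIONS --safe #-}
module Submission where

open import Defs
open import Data.Nat using (ℕ; zero; suc; _<_; _>_; _≤_; _∸_; _≤ᵇ_; z≤n; s≤s)
open import Data.Nat.Properties using (≤ᵇ⇒≤; <⇒≱; n<1+n)
open import Data.Bool using (true; false; T)
open import Data.List using ([]; _∷_)
open import Data.List.Relation.Unary.Linked using (Linked; []; [-]; _∷_)
open import Data.Product using (Σ; _×_; _,_)
open import Relation.Binary.PropositionalEquality using (_≡_; _≢_; refl; sym; subst)
open import Relation.Nullary using (contradiction)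

-- For m ≥ 5, entries 6, …, m + 3 fill the second row of (3, m) right to left and
-- 5 opens the first row; entries 1–4 then complete the rows either alternately
-- (columns m, 3, m − 1, 2) or second row first (3, 2, m, m − 1).  Both column
-- sequences rise exactly at positions 2 and 5, and the two chains differ.

≤ᵇ-false : ∀ {a b} → b < a → (a ≤ᵇ b) ≡ false
≤ᵇ-false {a} {b} b<a with a ≤ᵇ b in eq
... | false = refl
... | true  = contradiction (≤ᵇ⇒≤ a b (subst T (sym eq) _)) (<⇒≱ b<a)

desFrom-decreasing : ∀ i {xs} → Linked _>_ xs → desFrom i xs ≡ []
desFrom-decreasing i []          = refl
desFrom-decreasing i [-]         = refl
desFrom-decreasing i (a>b ∷ bxs) rewrite ≤ᵇ-false a>b = desFrom-decreasing (suc i) bxs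

singleRow : (k : ℕ) → SCT (suc k ∷ [])
singleRow zero    = step prepend empty
singleRow (suc k) = step (incr (suc k) here) (singleRow k)

columns-singleRow-decreasing : ∀ k → Linked _>_ (columns (singleRow k))
columns-singleRow-decreasing zero          = [-]
columns-singleRow-decreasing (suc zero)    = n<1+n 1 ∷ [-]
columns-singleRow-decreasing (suc (suc k)) = n<1+n (suc (suc k)) ∷ columns-singleRow-decreasing (suc k)

Des-singleRow : ∀ i k → desFrom i (columns (singleRow k)) ≡ []
Des-singleRow i k = desFrom-decreasing i (columns-singleRow-decreasing k)

hook : (k : ℕ) → SCT (1 ∷ suc (suc (suc k)) ∷ [])
hook k = step prepend (singleRow (suc (suc k)))

alternating : (k : ℕ) → SCT (3 ∷ suc (suc (suc (suc (suc k)))) ∷ [])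
alternating k =
  step (incr (suc (suc (suc (suc k)))) (there refl here))
  (step (incr 2 here)
  (step (incr (suc (suc (suc k))) (there refl here))
  (step (incr 1 here)
  (hook k))))

secondRowFirst : (k : ℕ) → SCT (3 ∷ suc (suc (suc (suc (suc k)))) ∷ [])
secondRowFirst k =
  step (incr 2 here)
  (step (incr 1 here)
  (step (incr (suc (suc (suc (suc k)))) (there refl here))
  (step (incr (suc (suc (suc k))) (there refl here))
  (hook k))))

Des-alternating : ∀ k → Des (alternating k) ≡ 2 ∷ 5 ∷ []
Des-alternating k rewrite ≤ᵇ-false (n<1+n k) | Des-singleRow 7 (suc k) = refl

Des-secondRowFirst : ∀ k → Des (secondRowFirst k) ≡ 2 ∷ 5 ∷ []
Des-secondRowFirst k rewrite ≤ᵇ-false (n<1+n k) | Des-singleRow 7 (suc k) = refl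

lemma5p3 : (n : ℕ) → 8 ≤ n →
    Σ (SCT (3 ∷ (n ∸ 3) ∷ [])) λ T₁ → Σ (SCT (3 ∷ (n ∸ 3) ∷ [])) λ T₂ →
      (shapes T₁ ≢ shapes T₂) × (Des T₁ ≡ 2 ∷ 5 ∷ []) × (Des T₂ ≡ 2 ∷ 5 ∷ [])
lemma5p3 (suc (suc (suc (suc (suc (suc (suc (suc k))))))))
  (s≤s (s≤s (s≤s (s≤s (s≤s (s≤s (s≤s (s≤s z≤n)))))))) =
  alternating k , secondRowFirst k , (λ ()) , Des-alternating k , Des-secondRowFirst k
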